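{- Let $p$ be an odd prime and $n = 2p$. Let $S$ be the multiset $\{1,1,1,2,2,3,3,\dots,p-1,p-1\}$ of size $2p-1$ (the value $1$ appearing three times and each of $2, \dots, p-1$ appearing twice). Then there exists an exponential orthomorphism modulo $n$ if and only if there exist $a_1, \dots, a_{p-1}, b_1, \dots, b_{p-1}, c$ such that the multiset $\{a_1, \dots, a_{p-1}, b_1, \dots, b_{p-1}, c\}$ equals $S$, and such that both $(a_1, 2a_2, \dots, (p-1)a_{p-1})$ and $(b_1, 2b_2, \dots, (p-1)b_{p-1})$, with entries reduced modulo $p-1$, are permutations of $\mathbb{Z}/(p-1)$.
   Context: For an integer $n \ge 2$, an exponential orthomorphism modulo $n$ is a permutation $\sigma$ of $\{1, \dots, n-1\}$ such that the map $x \mapsto x^{\sigma(x)} \bmod n$ is also a bijection of $\{1, \dots, n-1\}$. -}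

module Defs where

open import Data.Nat using (ℕ; zero; suc; _+_; _*_; _∸_; _^_; NonZero)
open import Data.Nat.DivMod using (_%_)
open import Data.Fin using (Fin; toℕ)
open import Data.Fin.Permutation using (Permutation′; _⟨$⟩ʳ_)
open import Data.List using (List; []; _∷_; _++_; upTo; concatMap)
open import Data.Vec.Functional using (Vector; toList)
open import Data.Product using (Σ; ∃; _×_)
open import Relation.Binary.PropositionalEquality using (_≡_)

elt : ∀ {m} → Fin m → ℕ
elt i = suc (toℕ i)

-- An exponential orthomorphism modulo n: a permutation σ of {1,…,n-1}
-- (encoded as a permutation of Fin (n ∸ 1) via elt) such that
-- x ↦ x ^ σ(x) mod n is also a bijection of {1,…,n-1}, i.e. there is a
-- permutation τ of {1,…,n-1} with x ^ σ(x) mod n ≡ τ(x) for all x.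
ExpOrthomorphism : (n : ℕ) → .{{NonZero n}} → Set
ExpOrthomorphism n =
  Σ (Permutation′ (n ∸ 1)) λ σ →
    Σ (Permutation′ (n ∸ 1)) λ τ →
      ∀ i → (elt i ^ elt (σ ⟨$⟩ʳ i)) % n ≡ elt (τ ⟨$⟩ʳ i)

multisetS : ℕ → List ℕ
multisetS p = 1 ∷ concatMap (λ k → suc k ∷ suc k ∷ []) (upTo (p ∸ 1))

-- (1·a₁, 2·a₂, …, m·a_m) reduced mod m is a permutation of ℤ/m
-- (here m = p - 1; entry i ∈ Fin m has index toℕ i + 1).
WeightedPerm : (m : ℕ) → .{{NonZero m}} → (Fin m → ℕ) → Set
WeightedPerm m a =
  Σ (Permutation′ m) λ π → ∀ i → (elt i * a i) % m ≡ toℕ (π ⟨$⟩ʳ i)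

module Submission where

-- Idea: fix a primitive root g mod p.  By the Chinese remainder theorem x < n is fixed
-- by its parity and its residue mod p, so {1,…,n-1} consists of an odd and an even
-- number with residue gʲ for each j ∈ {1,…,p-1}, plus p.  For e ≥ 1, xᵉ mod n keeps the
-- parity of x and has residue g^{j·e}, depending on j·e mod (p-1) only, while pᵉ stays
-- divisible by p.  So x ↦ x^{σ(x)} is injective iff the weighted exponents j·σ(x) are
-- distinct mod p-1 within each parity block, and the exponents reduced into {1,…,p-1}
-- form exactly S.

open import Defs
open import Data.Nat using (ℕ; suc; _∸_; _*_; NonZero)
open import Data.Nat.Primality using (Prime)
open import Data.Fin using (Fin)
open import Data.List using (_++_; _∷_; [])
open import Data.Vec.Functional using (toList)
open import Data.List.Relation.Binary.Permutation.Propositional using (_↭_)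
open import Data.Product using (Σ; _×_)
open import Function.Bundles using (_⇔_)

open import Data.Nat
open import Data.Nat.Properties
open import Data.Nat.DivMod
open import Data.Nat.Divisibility
open import Data.Nat.Primality
open import Data.Nat.Coprimality using (Coprime; coprime-divisor)
import Data.Nat.Coprimality as Coprime
open import Data.Nat.Primality.Factorisation using (factorise)
open import Data.Nat.ListAction using (product)
open import Data.Nat.Induction using (<-wellFounded)
open import Data.Nat.Solver using (module +-*-Solver)
open +-*-Solver using (solve; _:+_; _:*_; _:=_; con)
open import Induction.WellFounded using (Acc; acc)
open import Data.Fin using (toℕ; fromℕ<; zero; suc; punchIn; punchOut; _↑ˡ_; _↑ʳ_; cast; splitAt)
import Data.Fin.Properties as Fin
open import Data.Fin.Permutation using (Permutation; Permutation′; _⟨$⟩ʳ_; _⟨$⟩ˡ_)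
import Data.Fin.Permutation as Perm
import Data.Vec.Functional as Vector
import Data.Vec.Functional.Properties as Vector
open import Data.List using (List; length; replicate; applyUpTo; upTo; concatMap; map)
import Data.List as List
open import Data.List.Properties
  using (length-applyUpTo; length-replicate; tabulate-cong; length-tabulate; lookup-tabulate; map-applyUpTo; ++-assoc)
open import Data.List.Relation.Unary.All using (All; []; _∷_)
import Data.List.Relation.Unary.All.Properties as All
open import Data.List.Relation.Unary.AllPairs using ([]; _∷_)
open import Data.List.Relation.Unary.Unique.Propositional using (Unique)
import Data.List.Relation.Unary.Unique.Propositional.Properties as Unique
open import Data.List.Relation.Binary.Permutation.Propositional
  using (↭-refl; ↭-sym; ↭-trans; ↭-reflexive; prep; swap; ↭⇒↭ₛ; module PermutationReasoning)
open import Data.List.Relation.Binary.Permutation.Propositional.Properties using (shift; ∷↭∷ʳ)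
open import Data.List.Relation.Binary.Permutation.Homogeneous using (onIndices)
import Data.List.Relation.Binary.Permutation.Setoid.Properties as SetoidPermutation
open import Data.Product using (∃; ∃₂; _,_; proj₁; proj₂)
open import Data.Sum using (_⊎_; inj₁; inj₂; [_,_]′)
open import Data.Empty using (⊥-elim)
open import Function using (_∘′_; id)
open import Function.Bundles using (mk⇔; Equivalence; Inverse; Injection)
open import Function.Definitions using (Injective)
open import Function.Properties.Inverse using (↔⇒↣)
open import Relation.Nullary using (¬_; Dec; yes; no; contradiction)
open import Relation.Nullary.Decidable using (decidable-stable; ¬?)
open import Relation.Binary.PropositionalEquality

module _ {P : ℕ → Set} (P? : ∀ n → Dec (P n)) where

  private
    searchBelow : ∀ n → (∀ {m} → m < n → ¬ P m) ⊎ ∃ λ m → P m × (∀ {m′} → m′ < m → ¬ P m′)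
    searchBelow zero = inj₁ λ ()
    searchBelow (suc n) with searchBelow n
    ... | inj₂ found = inj₂ found
    ... | inj₁ none with P? n
    ...   | yes Pn = inj₂ (n , Pn , none)
    ...   | no ¬Pn = inj₁ λ m<1+n → [ none , (λ { refl → ¬Pn }) ]′ (m≤n⇒m<n∨m≡n (s≤s⁻¹ m<1+n))

  least : ∀ {n} → P n → ∃ λ m → P m × (∀ {m′} → m′ < m → ¬ P m′)
  least {n} Pn with searchBelow n
  ... | inj₁ none = n , Pn , none
  ... | inj₂ found = found

index : ∀ {d} r → 0 < r → r < d → Fin (d ∸ 1)
index {suc d} (suc r) _ r<d = fromℕ< (s≤s⁻¹ r<d)

elt-index : ∀ {d} r (0<r : 0 < r) (r<d : r < d) → elt (index r 0<r r<d) ≡ r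
elt-index {suc d} (suc r) _ r<d = cong suc (Fin.toℕ-fromℕ< _)

index-injective : ∀ {d r s} (0<r : 0 < r) (0<s : 0 < s) (r<d : r < d) (s<d : s < d) →
                  index r 0<r r<d ≡ index s 0<s s<d → r ≡ s
index-injective {r = r} {s} 0<r 0<s r<d s<d same =
  trans (sym (elt-index r 0<r r<d)) (trans (cong elt same) (elt-index s 0<s s<d))

elt-injective : ∀ {d} → Injective _≡_ _≡_ (elt {d})
elt-injective same = Fin.toℕ-injective (suc-injective same)

-- Congruence modulo a fixed nonzero modulus d, as equality of remainders.
-- Being an equality, it is manipulated with sym, trans and ≡-Reasoning.
module Congruence (d : ℕ) .{{_ : NonZero d}} where

  infix 4 _≈_
  _≈_ : ℕ → ℕ → Set
  a ≈ b = a % d ≡ b % d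

  %-≈ : ∀ a → a % d ≈ a
  %-≈ a = m%n%n≡m%n a d

  +-cong : ∀ {a a′ b b′} → a ≈ a′ → b ≈ b′ → a + b ≈ a′ + b′
  +-cong {a} {a′} {b} {b′} a≈a′ b≈b′ = begin
    (a + b) % d             ≡⟨ %-distribˡ-+ a b d ⟩
    (a % d + b % d) % d     ≡⟨ cong₂ (λ u v → (u + v) % d) a≈a′ b≈b′ ⟩
    (a′ % d + b′ % d) % d   ≡⟨ %-distribˡ-+ a′ b′ d ⟨
    (a′ + b′) % d           ∎
    where open ≡-Reasoning

  *-cong : ∀ {a a′ b b′} → a ≈ a′ → b ≈ b′ → a * b ≈ a′ * b′
  *-cong {a} {a′} {b} {b′} a≈a′ b≈b′ = begin
    (a * b) % d             ≡⟨ %-distribˡ-* a b d ⟩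
    (a % d * (b % d)) % d   ≡⟨ cong₂ (λ u v → (u * v) % d) a≈a′ b≈b′ ⟩
    (a′ % d * (b′ % d)) % d ≡⟨ %-distribˡ-* a′ b′ d ⟨
    (a′ * b′) % d           ∎
    where open ≡-Reasoning

  ^-cong : ∀ {a b} e → a ≈ b → a ^ e ≈ b ^ e
  ^-cong zero    a≈b = refl
  ^-cong (suc e) a≈b = *-cong a≈b (^-cong e a≈b)

  0%d≡0 : 0 % d ≡ 0
  0%d≡0 = m<n⇒m%n≡m (>-nonZero⁻¹ d)

  ≈0⇒∣ : ∀ {a} → a ≈ 0 → d ∣ a
  ≈0⇒∣ {a} a≈0 = m%n≡0⇒n∣m a d (trans a≈0 0%d≡0)

  ∣⇒≈0 : ∀ {a} → d ∣ a → a ≈ 0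
  ∣⇒≈0 {a} d∣a = trans (n∣m⇒m%n≡0 a d d∣a) (sym 0%d≡0)

  ≈⇒∣∸ : ∀ {a b} → a ≈ b → d ∣ a ∸ b
  ≈⇒∣∸ {a} {b} a≈b = divides (a / d ∸ b / d) (begin
    a ∸ b                                       ≡⟨ cong₂ _∸_ (m≡m%n+[m/n]*n a d) (m≡m%n+[m/n]*n b d) ⟩
    (a % d + a / d * d) ∸ (b % d + b / d * d)   ≡⟨ cong (λ r → (r + a / d * d) ∸ (b % d + b / d * d)) a≈b ⟩
    (b % d + a / d * d) ∸ (b % d + b / d * d)   ≡⟨ [m+n]∸[m+o]≡n∸o (b % d) (a / d * d) (b / d * d) ⟩
    a / d * d ∸ b / d * d                       ≡⟨ *-distribʳ-∸ d (a / d) (b / d) ⟨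
    (a / d ∸ b / d) * d                         ∎)
    where open ≡-Reasoning

  ≤∧∣∸⇒≈ : ∀ {a b} → b ≤ a → d ∣ a ∸ b → a ≈ b
  ≤∧∣∸⇒≈ {a} {b} b≤a d∣a∸b = begin
    a % d             ≡⟨ cong (_% d) (m+[n∸m]≡n b≤a) ⟨
    (b + (a ∸ b)) % d ≡⟨ %-remove-+ʳ b d∣a∸b ⟩
    b % d             ∎
    where open ≡-Reasoning

  ∣∸⇒≈ : ∀ {a b} → d ∣ a ∸ b → d ∣ b ∸ a → a ≈ b
  ∣∸⇒≈ {a} {b} d∣a∸b d∣b∸a with ≤-total b a
  ... | inj₁ b≤a = ≤∧∣∸⇒≈ b≤a d∣a∸b
  ... | inj₂ a≤b = sym (≤∧∣∸⇒≈ a≤b d∣b∸a)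

  ∣∧<⇒≡0 : ∀ {x} → d ∣ x → x < d → x ≡ 0
  ∣∧<⇒≡0 {zero}  _   _   = refl
  ∣∧<⇒≡0 {suc x} d∣x x<d = ⊥-elim (<⇒≱ x<d (∣⇒≤ d∣x))

  ∣∸⇒≡ : ∀ {a b} → a ∸ b < d → b ∸ a < d → d ∣ a ∸ b → d ∣ b ∸ a → a ≡ b
  ∣∸⇒≡ a∸b<d b∸a<d d∣a∸b d∣b∸a =
    ≤-antisym (m∸n≡0⇒m≤n (∣∧<⇒≡0 d∣a∸b a∸b<d)) (m∸n≡0⇒m≤n (∣∧<⇒≡0 d∣b∸a b∸a<d))

  ≈⇒≡ : ∀ {a b} → a ∸ b < d → b ∸ a < d → a ≈ b → a ≡ b
  ≈⇒≡ a∸b<d b∸a<d a≈b = ∣∸⇒≡ a∸b<d b∸a<d (≈⇒∣∸ a≈b) (≈⇒∣∸ (sym a≈b))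

module PrimeModulus (p : ℕ) (p-prime : Prime p) where

  instance
    p≢0 : NonZero p
    p≢0 = prime⇒nonZero p-prime

  open Congruence p public

  1<p : 1 < p
  1<p = nonTrivial⇒n>1 p {{prime⇒nonTrivial p-prime}}

  1+[p∸1]≡p : suc (p ∸ 1) ≡ p
  1+[p∸1]≡p = m+[n∸m]≡n (<⇒≤ 1<p)

  <p⇒≤p∸1 : ∀ {r} → r < p → r ≤ p ∸ 1
  <p⇒≤p∸1 r<p = s≤s⁻¹ (subst (_ <_) (sym 1+[p∸1]≡p) r<p)

  1≉0 : ¬ 1 ≈ 0
  1≉0 1≈0 = <⇒≢ 1<p (sym (∣1⇒≡1 (≈0⇒∣ 1≈0)))

  <p⇒≉0 : ∀ {x} → 0 < x → x < p → ¬ x ≈ 0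
  <p⇒≉0 {x} 0<x x<p x≈0 = <⇒≢ 0<x (sym (∣∧<⇒≡0 (≈0⇒∣ x≈0) x<p))

  *-≈0 : ∀ {x y} → x * y ≈ 0 → x ≈ 0 ⊎ y ≈ 0
  *-≈0 {x} {y} xy≈0 with euclidsLemma x y p-prime (≈0⇒∣ xy≈0)
  ... | inj₁ p∣x = inj₁ (∣⇒≈0 p∣x)
  ... | inj₂ p∣y = inj₂ (∣⇒≈0 p∣y)

  *-cancelˡ-≈ : ∀ {x a b} → ¬ x ≈ 0 → x * a ≈ x * b → a ≈ b
  *-cancelˡ-≈ {x} {a} {b} x≉0 xa≈xb =
    ∣∸⇒≈ (cancel a b (≈⇒∣∸ xa≈xb)) (cancel b a (≈⇒∣∸ (sym xa≈xb)))
    where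
      cancel : ∀ u v → p ∣ x * u ∸ x * v → p ∣ u ∸ v
      cancel u v p∣ with euclidsLemma x (u ∸ v) p-prime (subst (p ∣_) (sym (*-distribˡ-∸ x u v)) p∣)
      ... | inj₁ p∣x   = ⊥-elim (x≉0 (∣⇒≈0 p∣x))
      ... | inj₂ p∣u∸v = p∣u∸v

  *-cancelʳ-≢ : ∀ {r s q} → r ≢ s → r < p → s < p → r * q ≈ s * q → q ≈ 0
  *-cancelʳ-≢ {r} {s} {q} r≢s r<p s<p rq≈sq = decidable-stable (q % p ≟ 0 % p) λ q≉0 →
    r≢s (≈⇒≡ (≤-<-trans (m∸n≤m r s) r<p) (≤-<-trans (m∸n≤m s r) s<p)
      (*-cancelˡ-≈ q≉0 (subst₂ _≈_ (*-comm r q) (*-comm s q) rq≈sq)))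

  -- The monic polynomial xᵏ + c_{k-1}xᵏ⁻¹ + … + c₀, given by [c₀, …, c_{k-1}].
  monic : List ℕ → ℕ → ℕ
  monic []       x = 1
  monic (c ∷ cs) x = c + x * monic cs x

  -- Synthetic division of a monic polynomial by x - r.
  divideBy : ℕ → List ℕ → List ℕ
  divideBy r []       = []
  divideBy r (c ∷ cs) = monic (c ∷ cs) r ∷ divideBy r cs

  length-divideBy : ∀ r cs → length (divideBy r cs) ≡ length cs
  length-divideBy r []       = refl
  length-divideBy r (c ∷ cs) = cong suc (length-divideBy r cs)

  -- f(x) - f(r) = (x - r) · q(x), written without subtraction.
  divideBy-correct : ∀ r c cs x →
    monic (c ∷ cs) x + r * monic (divideBy r cs) x ≡ x * monic (divideBy r cs) x + monic (c ∷ cs) r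
  divideBy-correct r c [] x =
    solve 3 (λ c x r → c :+ x :* con 1 :+ r :* con 1 := x :* con 1 :+ (c :+ r :* con 1)) refl c x r
  divideBy-correct r c (c′ ∷ cs) x = begin
    c + x * B + r * (A + x * Q)
      ≡⟨ solve 6 (λ c x B r A Q → c :+ x :* B :+ r :* (A :+ x :* Q) := c :+ r :* A :+ x :* (B :+ r :* Q))
                 refl c x B r A Q ⟩
    c + r * A + x * (B + r * Q)   ≡⟨ cong (λ u → c + r * A + x * u) (divideBy-correct r c′ cs x) ⟩
    c + r * A + x * (x * Q + A)
      ≡⟨ solve 5 (λ c x r A Q → c :+ r :* A :+ x :* (x :* Q :+ A) := x :* (A :+ x :* Q) :+ (c :+ r :* A))
                 refl c x r A Q ⟩
    x * (A + x * Q) + (c + r * A) ∎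
    where
      open ≡-Reasoning
      A = monic (c′ ∷ cs) r
      B = monic (c′ ∷ cs) x
      Q = monic (divideBy r cs) x

  Root : List ℕ → ℕ → Set
  Root cs r = monic cs r ≈ 0

  root-bound : ∀ cs rs → Unique rs → All (_< p) rs → All (Root cs) rs → length rs ≤ length cs
  root-bound cs       []       _            _            _            = z≤n
  root-bound []       (r ∷ rs) _            _            (root ∷ _)   = ⊥-elim (1≉0 root)
  root-bound (c ∷ cs) (r ∷ rs) (r∉rs ∷ rs!) (r<p ∷ rs<p) (root ∷ roots) =
    s≤s (subst (length rs ≤_) (length-divideBy r cs)
      (root-bound (divideBy r cs) rs rs! rs<p (quotient-roots r∉rs rs<p roots)))
    where
      quotient-root : ∀ {s} → r ≢ s → s < p → Root (c ∷ cs) s → Root (divideBy r cs) s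
      quotient-root {s} r≢s s<p s-root = *-cancelʳ-≢ r≢s r<p s<p (begin
        (r * Q) % p                    ≡⟨ +-cong {0} {monic (c ∷ cs) s} {r * Q} (sym s-root) refl ⟩
        (monic (c ∷ cs) s + r * Q) % p ≡⟨ cong (_% p) (divideBy-correct r c cs s) ⟩
        (s * Q + monic (c ∷ cs) r) % p ≡⟨ +-cong {s * Q} refl root ⟩
        (s * Q + 0) % p                ≡⟨ cong (_% p) (+-identityʳ (s * Q)) ⟩
        (s * Q) % p                    ∎)
        where
          open ≡-Reasoning
          Q = monic (divideBy r cs) s

      quotient-roots : ∀ {ss} → All (r ≢_) ss → All (_< p) ss → All (Root (c ∷ cs)) ss →
                       All (Root (divideBy r cs)) ss
      quotient-roots []            []            []            = []
      quotient-roots (r≢s ∷ r≢ss) (s<p ∷ ss<p) (s-root ∷ ss-roots) =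
        quotient-root r≢s s<p s-root ∷ quotient-roots r≢ss ss<p ss-roots

  monic-xᵏ : ∀ k x → monic (replicate k 0) x ≡ x ^ k
  monic-xᵏ zero    x = refl
  monic-xᵏ (suc k) x = cong (x *_) (monic-xᵏ k x)

  IsExponent : ℕ → Set
  IsExponent M = ∀ x → 0 < x → x < p → x ^ M ≈ 1

  -- A positive exponent is at least p - 1: the p - 1 nonzero residues are roots
  -- of xᴹ + (p - 1).
  exponent-bound : ∀ M → 1 ≤ M → IsExponent M → p ∸ 1 ≤ M
  exponent-bound (suc M) _ all≈1 =
    subst₂ _≤_ (length-applyUpTo suc (p ∸ 1)) (cong suc (length-replicate M))
      (root-bound ((p ∸ 1) ∷ replicate M 0) (applyUpTo suc (p ∸ 1))
        (Unique.applyUpTo⁺₁ suc (p ∸ 1) (λ i<j _ i≡j → <⇒≢ i<j (suc-injective i≡j)))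
        (All.applyUpTo⁺₁ suc (p ∸ 1) below-p)
        (All.applyUpTo⁺₁ suc (p ∸ 1) λ i<p-1 → root (suc _) z<s (below-p i<p-1)))
    where
      below-p : ∀ {i} → i < p ∸ 1 → suc i < p
      below-p {i} i<p-1 = subst (suc i <_) 1+[p∸1]≡p (s≤s i<p-1)
      root : ∀ x → 0 < x → x < p → Root ((p ∸ 1) ∷ replicate M 0) x
      root x 0<x x<p = begin
        (p ∸ 1 + x * monic (replicate M 0) x) % p ≡⟨ cong (λ u → (p ∸ 1 + x * u) % p) (monic-xᵏ M x) ⟩
        (p ∸ 1 + x ^ suc M) % p                   ≡⟨ +-cong {p ∸ 1} refl (all≈1 x 0<x x<p) ⟩
        (p ∸ 1 + 1) % p                           ≡⟨ cong (_% p) (trans (+-comm (p ∸ 1) 1) 1+[p∸1]≡p) ⟩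
        p % p                                     ≡⟨ n%n≡0 p ⟩
        0                                         ≡⟨ 0%d≡0 ⟨
        0 % p                                     ∎
        where open ≡-Reasoning

prime-divisor : ∀ {n} → 1 < n → ∃ λ q → Prime q × q ∣ n
prime-divisor {n} 1<n with factorise n {{>-nonZero (<-trans z<s 1<n)}}
... | record { factors = [] ; isFactorisation = n≡1 } = ⊥-elim (<⇒≢ 1<n (sym n≡1))
... | record { factors = q ∷ qs ; isFactorisation = n≡q*qs ; factorsPrime = q-prime ∷ _ } =
  q , q-prime , divides (product qs) (trans n≡q*qs (*-comm q (product qs)))

coprime-*ʳ : ∀ {a b c} → Coprime a b → Coprime a c → Coprime a (b * c)
coprime-*ʳ a⊥b a⊥c (i∣a , i∣bc) =
  a⊥c (i∣a , coprime-divisor (λ (j∣i , j∣b) → a⊥b (∣-trans j∣i i∣a , j∣b)) i∣bc)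

coprime-^ʳ : ∀ {a q} f → Coprime a q → Coprime a (q ^ f)
coprime-^ʳ zero    a⊥q (_ , i∣1) = ∣1⇒≡1 i∣1
coprime-^ʳ (suc f) a⊥q = coprime-*ʳ a⊥q (coprime-^ʳ f a⊥q)

prime∤⇒coprime : ∀ {q a} → Prime q → ¬ q ∣ a → Coprime a q
prime∤⇒coprime q-prime q∤a (i∣a , i∣q) with prime⇒irreducible q-prime i∣q
... | inj₁ i≡1 = i≡1
... | inj₂ refl = ⊥-elim (q∤a i∣a)

coprime-∣⇒*∣ : ∀ {a b n} → Coprime a b → a ∣ n → b ∣ n → a * b ∣ n
coprime-∣⇒*∣ {a} {b} a⊥b (divides k refl) b∣ka =
  subst (a * b ∣_) (*-comm a k) (*-monoʳ-∣ a (coprime-divisor (Coprime.sym a⊥b) (subst (b ∣_) (*-comm k a) b∣ka)))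

^-distribʳ-* : ∀ x y e → (x * y) ^ e ≡ x ^ e * y ^ e
^-distribʳ-* x y zero    = refl
^-distribʳ-* x y (suc e) = trans (cong (x * y *_) (^-distribʳ-* x y e)) ([m*n]*[o*p]≡[m*o]*[n*p] x y (x ^ e) (y ^ e))

prime>1 : ∀ {q} → Prime q → 1 < q
prime>1 {q} q-prime = nonTrivial⇒n>1 q {{prime⇒nonTrivial q-prime}}

scale-witness : ∀ {q b′ M′} → Prime q → (∃₂ λ r f → Prime r × r ^ f ∣ b′ × ¬ r ^ f ∣ M′) →
                ∃₂ λ r f → Prime r × r ^ f ∣ b′ * q × ¬ r ^ f ∣ M′ * q
scale-witness {q} {b′} {M′} q-prime (r , f , r-prime , rᶠ∣b′ , rᶠ∤M′) with r ≟ q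
... | yes refl = r , suc f , r-prime , subst (r ^ suc f ∣_) (*-comm r b′) (*-monoʳ-∣ r rᶠ∣b′) ,
                 λ r¹⁺ᶠ∣M′r → rᶠ∤M′ (*-cancelˡ-∣ r {{prime⇒nonZero r-prime}}
                                        (subst (r ^ suc f ∣_) (*-comm M′ r) r¹⁺ᶠ∣M′r))
... | no r≢q = r , f , r-prime , ∣-trans rᶠ∣b′ (m∣m*n q) ,
               λ rᶠ∣M′q → rᶠ∤M′ (coprime-divisor rᶠ⊥q (subst (r ^ f ∣_) (*-comm M′ q) rᶠ∣M′q))
  where
    r∤q : ¬ r ∣ q
    r∤q r∣q with prime⇒irreducible q-prime r∣q
    ... | inj₁ r≡1 = <⇒≢ (prime>1 r-prime) (sym r≡1)
    ... | inj₂ r≡q = r≢q r≡q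
    rᶠ⊥q : Coprime (r ^ f) q
    rᶠ⊥q = Coprime.sym (coprime-^ʳ f (prime∤⇒coprime r-prime r∤q))

-- If b ∤ M, some prime power divides b but not M.  By strong induction on b:
-- take a prime q ∣ b; if q ∤ M we are done, otherwise recurse on b/q and M/q.
prime-power-witness : ∀ {b M} → 0 < b → ¬ b ∣ M → ∃₂ λ q f → Prime q × q ^ f ∣ b × ¬ q ^ f ∣ M
prime-power-witness {b} = go b (<-wellFounded b)
  where
    go : ∀ b {M} → Acc _<_ b → 0 < b → ¬ b ∣ M → ∃₂ λ q f → Prime q × q ^ f ∣ b × ¬ q ^ f ∣ M
    go (suc zero) {M} _ _ 1∤M = ⊥-elim (1∤M (1∣ M))
    go b@(suc (suc _)) {M} (acc smaller) _ b∤M with prime-divisor {b} (s≤s (s≤s z≤n))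
    ... | q , q-prime , divides b′ b≡b′q with q ∣? M
    ...   | no q∤M = q , 1 , q-prime , subst (_∣ b) (sym (*-identityʳ q)) (divides b′ b≡b′q) ,
                     λ q¹∣M → q∤M (subst (_∣ M) (*-identityʳ q) q¹∣M)
    ...   | yes (divides M′ M≡M′q) =
      subst₂ (λ b M → ∃₂ λ r f → Prime r × r ^ f ∣ b × ¬ r ^ f ∣ M) (sym b≡b′q) (sym M≡M′q)
        (scale-witness q-prime (go b′ (smaller b′<b) 0<b′ b′∤M′))
      where
        0<b′ : 0 < b′
        0<b′ = n≢0⇒n>0 λ b′≡0 → 0≢1+n (sym (trans b≡b′q (cong (_* q) b′≡0)))
        b′<b : b′ < b
        b′<b = subst (b′ <_) (sym b≡b′q) (m<m*n b′ q {{>-nonZero 0<b′}} (prime>1 q-prime))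
        b′∤M′ : ¬ b′ ∣ M′
        b′∤M′ b′∣M′ = b∤M (subst₂ _∣_ (sym b≡b′q) (sym M≡M′q) (*-pres-∣ b′∣M′ (∣-refl {q})))

split-prime-power : ∀ {q M} → Prime q → 0 < M → ∃₂ λ e M′ → M ≡ q ^ e * M′ × ¬ q ∣ M′
split-prime-power {q} {M} q-prime = go M (<-wellFounded M)
  where
    go : ∀ M → Acc _<_ M → 0 < M → ∃₂ λ e M′ → M ≡ q ^ e * M′ × ¬ q ∣ M′
    go M (acc smaller) 0<M with q ∣? M
    ... | no q∤M = 0 , M , sym (+-identityʳ M) , q∤M
    ... | yes (divides M₀ M≡M₀q) with go M₀ (smaller M₀<M) 0<M₀
      where
        0<M₀ : 0 < M₀
        0<M₀ = n≢0⇒n>0 λ M₀≡0 → <⇒≢ 0<M (sym (trans M≡M₀q (cong (_* q) M₀≡0)))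
        M₀<M : M₀ < M
        M₀<M = subst (M₀ <_) (sym M≡M₀q) (m<m*n M₀ q {{>-nonZero 0<M₀}} (prime>1 q-prime))
    ...   | e , M′ , M₀≡qᵉM′ , q∤M′ = suc e , M′ , M≡q¹⁺ᵉM′ , q∤M′
      where
        open ≡-Reasoning
        M≡q¹⁺ᵉM′ : M ≡ q ^ suc e * M′
        M≡q¹⁺ᵉM′ = begin
          M                 ≡⟨ M≡M₀q ⟩
          M₀ * q            ≡⟨ cong (_* q) M₀≡qᵉM′ ⟩
          q ^ e * M′ * q    ≡⟨ *-comm (q ^ e * M′) q ⟩
          q * (q ^ e * M′)  ≡⟨ *-assoc q (q ^ e) M′ ⟨
          q ^ suc e * M′    ∎

-- Multiplicative orders modulo a prime, and the existence of a primitive root.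
module Orders (p : ℕ) (p-prime : Prime p) where

  open PrimeModulus p p-prime

  Unit : ℕ → Set
  Unit x = ¬ x ≈ 0

  unit-* : ∀ {x y} → Unit x → Unit y → Unit (x * y)
  unit-* ux uy xy≈0 with *-≈0 xy≈0
  ... | inj₁ x≈0 = ux x≈0
  ... | inj₂ y≈0 = uy y≈0

  unit-^ : ∀ {x} e → Unit x → Unit (x ^ e)
  unit-^ zero    ux = 1≉0
  unit-^ (suc e) ux = unit-* ux (unit-^ e ux)

  record IsOrder (x d : ℕ) : Set where
    field
      positive : 0 < d
      period   : x ^ d ≈ 1
      divides-exponents : ∀ e → x ^ e ≈ 1 → d ∣ e

  open IsOrder

  ^-≈1 : ∀ {x d} k → x ^ d ≈ 1 → x ^ (d * k) ≈ 1
  ^-≈1 {x} {d} k xᵈ≈1 = begin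
    x ^ (d * k) % p ≡⟨ cong (_% p) (^-*-assoc x d k) ⟨
    (x ^ d) ^ k % p ≡⟨ ^-cong k xᵈ≈1 ⟩
    1 ^ k % p       ≡⟨ cong (_% p) (^-zeroˡ k) ⟩
    1 % p           ∎
    where open ≡-Reasoning

  order-∣⇒≈1 : ∀ {x d e} → IsOrder x d → d ∣ e → x ^ e ≈ 1
  order-∣⇒≈1 {x} {d} oˣ (divides k refl) = subst (λ t → x ^ t ≈ 1) (*-comm d k) (^-≈1 {x} {d} k (period oˣ))

  ^-reduce : ∀ {x d} .{{_ : NonZero d}} → x ^ d ≈ 1 → ∀ e → x ^ e ≈ x ^ (e % d)
  ^-reduce {x} {d} xᵈ≈1 e = begin
    x ^ e % p                           ≡⟨ cong (λ t → x ^ t % p) (m≡m%n+[m/n]*n e d) ⟩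
    x ^ (e % d + e / d * d) % p         ≡⟨ cong (_% p) (^-distribˡ-+-* x (e % d) (e / d * d)) ⟩
    (x ^ (e % d) * x ^ (e / d * d)) % p ≡⟨ *-cong {x ^ (e % d)} refl xᵏᵈ≈1 ⟩
    (x ^ (e % d) * 1) % p               ≡⟨ cong (_% p) (*-identityʳ (x ^ (e % d))) ⟩
    x ^ (e % d) % p                     ∎
    where
      open ≡-Reasoning
      xᵏᵈ≈1 : x ^ (e / d * d) ≈ 1
      xᵏᵈ≈1 = trans (cong (λ t → x ^ t % p) (*-comm (e / d) d)) (^-≈1 {x} {d} (e / d) xᵈ≈1)

  *-cancel-to-1 : ∀ {x a} → Unit x → x * a ≈ x → a ≈ 1
  *-cancel-to-1 {x} ux xa≈x = *-cancelˡ-≈ ux (trans xa≈x (cong (_% p) (sym (*-identityʳ x))))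

  order-∣-gap : ∀ {x d a b} → Unit x → IsOrder x d → x ^ a ≈ x ^ b → d ∣ a ∸ b
  order-∣-gap {x} {d} {a} {b} ux oˣ xᵃ≈xᵇ with ≤-total b a
  ... | inj₂ a≤b = subst (d ∣_) (sym (m≤n⇒m∸n≡0 a≤b)) (d ∣0)
  ... | inj₁ b≤a = divides-exponents oˣ (a ∸ b) (*-cancel-to-1 (unit-^ b ux) (begin
    x ^ b * x ^ (a ∸ b) % p ≡⟨ cong (_% p) (^-distribˡ-+-* x b (a ∸ b)) ⟨
    x ^ (b + (a ∸ b)) % p   ≡⟨ cong (λ t → x ^ t % p) (m+[n∸m]≡n b≤a) ⟩
    x ^ a % p               ≡⟨ xᵃ≈xᵇ ⟩
    x ^ b % p               ∎))
    where open ≡-Reasoning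

  ^-≈⇔ : ∀ {x d a b} .{{_ : NonZero d}} → Unit x → IsOrder x d → x ^ a ≈ x ^ b ⇔ a % d ≡ b % d
  ^-≈⇔ {x} {d} {a} {b} ux oˣ = mk⇔
    (λ xᵃ≈xᵇ → Congruence.∣∸⇒≈ d (order-∣-gap {a = a} {b} ux oˣ xᵃ≈xᵇ)
                                  (order-∣-gap {a = b} {a} ux oˣ (sym xᵃ≈xᵇ)))
    λ a≡b → trans (^-reduce {x} {d} (period oˣ) a) (trans (cong (λ t → x ^ t % p) a≡b) (sym (^-reduce {x} {d} (period oˣ) b)))

  unit-residue>0 : ∀ {x} → Unit x → 0 < x % p
  unit-residue>0 ux = n≢0⇒n>0 λ r≡0 → ux (trans r≡0 (sym 0%d≡0))

  ShortPeriod : ℕ → Set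
  ShortPeriod x = ∃ λ e → 0 < e × e ≤ p ∸ 1 × x ^ e ≈ 1

  -- Every unit has a short period: by pigeonhole two of the p powers
  -- x⁰, …, x^{p-1} share one of the p - 1 nonzero residues.
  short-period : ∀ {x} → Unit x → ShortPeriod x
  short-period {x} ux = from-collision (Fin.pigeonhole (≤-reflexive 1+[p∸1]≡p) slot)
    where
      residue>0 : ∀ (i : Fin p) → 0 < x ^ toℕ i % p
      residue>0 i = unit-residue>0 (unit-^ (toℕ i) ux)

      slot : Fin p → Fin (p ∸ 1)
      slot i = index {p} (x ^ toℕ i % p) (residue>0 i) (m%n<n _ p)

      from-collision : (∃₂ λ i j → toℕ i < toℕ j × slot i ≡ slot j) → ShortPeriod x
      from-collision (i , j , i<j , same-slot) =
        toℕ j ∸ toℕ i , m<n⇒0<n∸m i<j , ≤-trans (m∸n≤m (toℕ j) (toℕ i)) (<p⇒≤p∸1 (Fin.toℕ<n j)) ,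
        *-cancel-to-1 (unit-^ (toℕ i) ux) (begin
          x ^ toℕ i * x ^ (toℕ j ∸ toℕ i) % p ≡⟨ cong (_% p) (^-distribˡ-+-* x (toℕ i) (toℕ j ∸ toℕ i)) ⟨
          x ^ (toℕ i + (toℕ j ∸ toℕ i)) % p   ≡⟨ cong (λ t → x ^ t % p) (m+[n∸m]≡n (<⇒≤ i<j)) ⟩
          x ^ toℕ j % p                       ≡⟨ same-residue ⟨
          x ^ toℕ i % p                       ∎)
        where
          open ≡-Reasoning
          same-residue : x ^ toℕ i % p ≡ x ^ toℕ j % p
          same-residue = index-injective {p} (residue>0 i) (residue>0 j) (m%n<n _ p) (m%n<n _ p) same-slot

  least-period⇒order : ∀ {x d} → 0 < d → x ^ d ≈ 1 → (∀ {r} → 0 < r → r < d → ¬ x ^ r ≈ 1) → IsOrder x d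
  least-period⇒order {x} {d} 0<d xᵈ≈1 no-smaller =
    record { positive = 0<d ; period = xᵈ≈1 ; divides-exponents = minimal }
    where
      instance d≢0 = >-nonZero 0<d
      minimal : ∀ e → x ^ e ≈ 1 → d ∣ e
      minimal e xᵉ≈1 = decidable-stable (d ∣? e) λ d∤e →
        no-smaller (n≢0⇒n>0 λ e%d≡0 → d∤e (m%n≡0⇒n∣m e d e%d≡0)) (m%n<n e d)
          (trans (sym (^-reduce {x} {d} xᵈ≈1 e)) xᵉ≈1)

  order-exists : ∀ {x} → Unit x → ∃ λ d → IsOrder x d
  order-exists {x} ux = from-cycle (short-period ux)
    where
      from-least : (∃ λ d → x ^ suc d ≈ 1 × (∀ {d′} → d′ < d → ¬ x ^ suc d′ ≈ 1)) → ∃ λ d → IsOrder x d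
      from-least (d , x¹⁺ᵈ≈1 , smaller-≉1) =
        suc d , least-period⇒order z<s x¹⁺ᵈ≈1 λ { {suc r} _ r<d → smaller-≉1 (s≤s⁻¹ r<d) }
      from-cycle : ShortPeriod x → ∃ λ d → IsOrder x d
      from-cycle (suc e , _ , _ , x¹⁺ᵉ≈1) = from-least (least (λ i → x ^ suc i % p ≟ 1 % p) {e} x¹⁺ᵉ≈1)

  order-bound : ∀ {x d} → Unit x → IsOrder x d → d ≤ p ∸ 1
  order-bound {x} {d} ux oˣ = bound (short-period ux)
    where
      bound : ShortPeriod x → d ≤ p ∸ 1
      bound (e , 0<e , e≤p-1 , xᵉ≈1) = ≤-trans (∣⇒≤ {{>-nonZero 0<e}} (divides-exponents oˣ e xᵉ≈1)) e≤p-1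

  order-^ : ∀ {x u w} → 0 < u → IsOrder x (u * w) → IsOrder (x ^ u) w
  order-^ {x} {u} {w} 0<u oˣ = record
    { positive = n≢0⇒n>0 λ { refl → <⇒≢ (positive oˣ) (sym (*-zeroʳ u)) }
    ; period = trans (cong (_% p) (^-*-assoc x u w)) (period oˣ)
    ; divides-exponents = λ e xᵘᵉ≈1 → *-cancelˡ-∣ u {{>-nonZero 0<u}}
        (divides-exponents oˣ (u * e) (trans (cong (_% p) (sym (^-*-assoc x u e))) xᵘᵉ≈1))
    }

  order-* : ∀ {x y a b} → Coprime a b → IsOrder x a → IsOrder y b → IsOrder (x * y) (a * b)
  order-* {x} {y} {a} {b} a⊥b oˣ oʸ = record
    { positive = *-mono-< (positive oˣ) (positive oʸ)
    ; period = begin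
        (x * y) ^ (a * b) % p         ≡⟨ cong (_% p) (^-distribʳ-* x y (a * b)) ⟩
        x ^ (a * b) * y ^ (a * b) % p ≡⟨ *-cong (order-∣⇒≈1 oˣ (m∣m*n b)) (order-∣⇒≈1 oʸ (n∣m*n a)) ⟩
        1 % p                         ∎
    ; divides-exponents = λ e xyᵉ≈1 → coprime-∣⇒*∣ a⊥b
        (coprime-divisor a⊥b (subst (a ∣_) (*-comm e b) (divides-exponents oˣ (e * b) (one-factor {x} {y} {b} {e} oʸ xyᵉ≈1))))
        (coprime-divisor (Coprime.sym a⊥b) (subst (b ∣_) (*-comm e a)
          (divides-exponents oʸ (e * a) (one-factor {y} {x} {a} {e} oˣ (trans (cong (λ t → t ^ e % p) (*-comm y x)) xyᵉ≈1)))))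
    }
    where
      open ≡-Reasoning
      one-factor : ∀ {u v c e} → IsOrder v c → (u * v) ^ e ≈ 1 → u ^ (e * c) ≈ 1
      one-factor {u} {v} {c} {e} oᵛ uvᵉ≈1 = begin
        u ^ (e * c) % p                 ≡⟨ cong (_% p) (*-identityʳ (u ^ (e * c))) ⟨
        u ^ (e * c) * 1 % p             ≡⟨ *-cong {u ^ (e * c)} refl (order-∣⇒≈1 oᵛ (n∣m*n e)) ⟨
        u ^ (e * c) * v ^ (e * c) % p   ≡⟨ cong (_% p) (^-distribʳ-* u v (e * c)) ⟨
        (u * v) ^ (e * c) % p           ≡⟨ ^-≈1 {u * v} {e} c uvᵉ≈1 ⟩
        1 % p                           ∎

  LargerOrder : ℕ → Set
  LargerOrder M = ∃₂ λ h M′ → Unit h × IsOrder h M′ × M < M′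

  -- If g has order M = qᵉ·M′ (q ∤ M′) and the order w·q^f of y has a prime-power
  -- factor q^f ∤ M, then g^{qᵉ}·y^w is a unit of order M′·q^f > M.
  combine-orders : ∀ {g M y b} → Unit g → IsOrder g M → Unit y → IsOrder y b →
                   (∃₂ λ q f → Prime q × q ^ f ∣ b × ¬ q ^ f ∣ M) →
                   LargerOrder M
  combine-orders {g} {M} {y} ug oᵍ uy oʸ (q , f , q-prime , divides w b≡wqᶠ , qᶠ∤M) =
    split (split-prime-power q-prime (positive oᵍ))
    where
      instance q≢0 = prime⇒nonZero q-prime
      0<w : 0 < w
      0<w = n≢0⇒n>0 λ { refl → <⇒≢ (positive oʸ) (sym b≡wqᶠ) }

      split : (∃₂ λ e M′ → M ≡ q ^ e * M′ × ¬ q ∣ M′) → LargerOrder M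
      split (e , M′ , M≡qᵉM′ , q∤M′) =
        g ^ (q ^ e) * y ^ w , M′ * q ^ f ,
        unit-* (unit-^ (q ^ e) ug) (unit-^ w uy) ,
        order-* (coprime-^ʳ f (prime∤⇒coprime q-prime q∤M′))
          (order-^ (m^n>0 q e) (subst (IsOrder g) M≡qᵉM′ oᵍ))
          (order-^ 0<w (subst (IsOrder y) b≡wqᶠ oʸ)) ,
        M<M′qᶠ
        where
          M≡M′qᵉ : M ≡ M′ * q ^ e
          M≡M′qᵉ = trans M≡qᵉM′ (*-comm (q ^ e) M′)
          0<M′ : 0 < M′
          0<M′ = n≢0⇒n>0 λ { refl → <⇒≢ (positive oᵍ) (sym M≡M′qᵉ) }
          e<f : e < f
          e<f = ≰⇒> λ f≤e → qᶠ∤M (∣-trans (divides (q ^ (e ∸ f))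
            (trans (cong (q ^_) (sym (m∸n+n≡m f≤e))) (^-distribˡ-+-* q (e ∸ f) f))) (divides M′ M≡M′qᵉ))
          M<M′qᶠ : M < M′ * q ^ f
          M<M′qᶠ = subst (_< M′ * q ^ f) (sym M≡M′qᵉ)
            (*-monoʳ-< M′ {{>-nonZero 0<M′}} (^-monoʳ-< q (prime>1 q-prime) e<f))

  -- A unit y with yᴹ ≢ 1 has an order b ∤ M, so the order M of g can be enlarged.
  larger-order : ∀ {g M y} → Unit g → IsOrder g M → Unit y → ¬ y ^ M ≈ 1 →
                 LargerOrder M
  larger-order {g} {M} {y} ug oᵍ uy yᴹ≉1 = from-order (order-exists uy)
    where
      from-order : (∃ λ b → IsOrder y b) → LargerOrder M
      from-order (b , oʸ) =
        combine-orders ug oᵍ uy oʸ (prime-power-witness (positive oʸ) λ b∣M → yᴹ≉1 (order-∣⇒≈1 oʸ b∣M))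

  exponent-search : ∀ M → IsExponent M ⊎ ∃ λ y → Unit y × ¬ y ^ M ≈ 1
  exponent-search M = decide (anyUpTo? (λ i → ¬? (suc i ^ M % p ≟ 1 % p)) (p ∸ 1))
    where
      decide : Dec (∃ λ i → i < p ∸ 1 × ¬ suc i ^ M ≈ 1) →
               IsExponent M ⊎ ∃ λ y → Unit y × ¬ y ^ M ≈ 1
      decide (yes (i , i<p-1 , ¬≈1)) = inj₂ (suc i , <p⇒≉0 z<s (subst (suc i <_) 1+[p∸1]≡p (s≤s i<p-1)) , ¬≈1)
      decide (no no-counterexample) = inj₁ λ { (suc x) _ x<p →
        decidable-stable (suc x ^ M % p ≟ 1 % p) λ ¬≈1 → no-counterexample (x , <p⇒≤p∸1 x<p , ¬≈1) }

  -- A primitive root: enlarge the order of a unit until every unit satisfies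
  -- xᴹ ≡ 1, at which point M = p - 1 by exponent-bound.
  primitive-root : ∃ λ g → Unit g × IsOrder g (p ∸ 1)
  primitive-root = grow 1 1 1≉0 order-of-1 (<-wellFounded (p ∸ 1 ∸ 1))
    where
      order-of-1 : IsOrder 1 1
      order-of-1 = record { positive = z<s ; period = refl ; divides-exponents = λ e _ → 1∣ e }

      grow : ∀ g M → Unit g → IsOrder g M → Acc _<_ (p ∸ 1 ∸ M) → ∃ λ g → Unit g × IsOrder g (p ∸ 1)
      grow g M ug oᵍ (acc smaller) = step (exponent-search M)
        where
          step : IsExponent M ⊎ (∃ λ y → Unit y × ¬ y ^ M ≈ 1) →
                 ∃ λ g → Unit g × IsOrder g (p ∸ 1)
          step (inj₁ all≈1) = g , ug ,
            subst (IsOrder g) (≤-antisym (order-bound ug oᵍ) (exponent-bound M (positive oᵍ) all≈1)) oᵍ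
          step (inj₂ (y , uy , yᴹ≉1)) = continue (larger-order ug oᵍ uy yᴹ≉1)
            where
              continue : LargerOrder M → ∃ λ g → Unit g × IsOrder g (p ∸ 1)
              continue (h , M′ , uh , oʰ , M<M′) = grow h M′ uh oʰ (smaller (∸-monoʳ-< M<M′ (order-bound uh oʰ)))

permutation-injective : ∀ {a b} (π : Permutation a b) → Injective _≡_ _≡_ (π ⟨$⟩ʳ_)
permutation-injective π = Injection.injective (↔⇒↣ π)

-- If f : Fin n → Fin n misses a value y, punching y out turns f into an
-- injection Fin n → Fin (n ∸ 1), which cannot exist.
missing-value⇒¬injective : ∀ {n} (f : Fin n → Fin n) y → (∀ x → f x ≢ y) → ¬ Injective _≡_ _≡_ f
missing-value⇒¬injective {suc n} f y y∉f f-inj = <-irrefl refl (Fin.injective⇒≤ {f = squeeze} squeeze-inj)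
  where
    squeeze : Fin (suc n) → Fin n
    squeeze x = punchOut {i = y} {j = f x} (y∉f x ∘′ sym)
    squeeze-inj : Injective _≡_ _≡_ squeeze
    squeeze-inj eq = f-inj (Fin.punchOut-injective (y∉f _ ∘′ sym) (y∉f _ ∘′ sym) eq)

injective⇒surjective : ∀ {n} (f : Fin n → Fin n) → Injective _≡_ _≡_ f → ∀ y → ∃ λ x → f x ≡ y
injective⇒surjective f f-inj y with Fin.any? (λ x → f x Fin.≟ y)
... | yes hit = hit
... | no miss = ⊥-elim (missing-value⇒¬injective f y (λ x fx≡y → miss (x , fx≡y)) f-inj)

injective⇒permutation : ∀ {a b} → a ≡ b → (f : Fin a → Fin b) → Injective _≡_ _≡_ f →
                        Σ (Permutation a b) λ π → ∀ i → π ⟨$⟩ʳ i ≡ f i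
injective⇒permutation refl f f-inj =
  Perm.permutation f (λ y → proj₁ (onto y)) (λ y → proj₂ (onto y)) (λ x → f-inj (proj₂ (onto (f x)))) ,
  λ _ → refl
  where
    onto : ∀ y → ∃ λ x → f x ≡ y
    onto = injective⇒surjective f f-inj

toList-extract : ∀ {A : Set} {n} (f : Fin (suc n) → A) i → toList f ↭ f i ∷ toList (λ j → f (punchIn i j))
toList-extract f zero = ↭-refl
toList-extract {n = suc n} f (suc i) =
  ↭-trans (prep (f zero) (toList-extract (λ j → f (suc j)) i)) (swap (f zero) (f (suc i)) ↭-refl)

toList-permute : ∀ {A : Set} {a b} (f : Fin b → A) (π : Permutation a b) →
                 toList (λ i → f (π ⟨$⟩ʳ i)) ↭ toList f
toList-permute {a = zero}  {zero}  f π = ↭-refl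
toList-permute {a = zero}  {suc b} f π = ⊥-elim (Fin.¬Fin0 (π ⟨$⟩ˡ zero))
toList-permute {a = suc a} {zero}  f π = ⊥-elim (Fin.¬Fin0 (π ⟨$⟩ʳ zero))
toList-permute {a = suc a} {suc b} f π = begin
  f π₀ ∷ toList (λ j → f (π ⟨$⟩ʳ suc j))
    ≡⟨ cong (f π₀ ∷_) (tabulate-cong λ j → cong f (sym (Fin.punchIn-punchOut _))) ⟩
  f π₀ ∷ toList (λ j → f (punchIn π₀ (Perm.remove zero π ⟨$⟩ʳ j)))
    ↭⟨ prep (f π₀) (toList-permute (λ j → f (punchIn π₀ j)) (Perm.remove zero π)) ⟩
  f π₀ ∷ toList (λ j → f (punchIn π₀ j))
    ↭⟨ toList-extract f π₀ ⟨
  toList f ∎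
  where
    open PermutationReasoning
    π₀ : Fin (suc b)
    π₀ = π ⟨$⟩ʳ zero

↭⇒permutation : ∀ {A : Set} {a b} (f : Fin a → A) (g : Fin b → A) → toList f ↭ toList g →
                Σ (Permutation a b) λ ρ → ∀ t → f t ≡ g (ρ ⟨$⟩ʳ t)
↭⇒permutation {A} {a} {b} f g f↭g = ρ , f≡g∘ρ
  where
    module P = SetoidPermutation (setoid A)
    σ : Permutation (length (toList f)) (length (toList g))
    σ = onIndices (↭⇒↭ₛ f↭g)
    ρ : Permutation a b
    ρ = Perm.cast-id (sym (length-tabulate f)) Perm.∘ₚ σ Perm.∘ₚ Perm.cast-id (length-tabulate g)
    f≡g∘ρ : ∀ t → f t ≡ g (ρ ⟨$⟩ʳ t)
    f≡g∘ρ t = begin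
      f t                                                 ≡⟨ lookup-tabulate f t ⟨
      List.lookup (toList f) t′                           ≡⟨ P.onIndices-lookup (↭⇒↭ₛ f↭g) t′ ⟩
      List.lookup (toList g) j                            ≡⟨ cong (List.lookup (toList g)) (Fin.cast-involutive (sym lg) lg j) ⟨
      List.lookup (toList g) (cast (sym lg) (cast lg j))  ≡⟨ lookup-tabulate g (cast lg j) ⟩
      g (cast lg j)                                       ∎
      where
        open ≡-Reasoning
        lg : length (toList g) ≡ b
        lg = length-tabulate g
        t′ : Fin (length (toList f))
        t′ = cast (sym (length-tabulate f)) t
        j : Fin (length (toList g))
        j = Inverse.to σ t′

toList-split : ∀ {A : Set} a {b} (w : Fin (a + b) → A) →
               toList w ≡ toList (λ i → w (i ↑ˡ b)) ++ toList (λ i → w (a ↑ʳ i))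
toList-split zero    w = refl
toList-split (suc a) w = cong (w zero ∷_) (toList-split a (λ i → w (suc i)))

toList-applyUpTo : ∀ {A : Set} {n} (h : ℕ → A) → toList (λ (i : Fin n) → h (toℕ i)) ≡ applyUpTo h n
toList-applyUpTo {n = zero}  h = refl
toList-applyUpTo {n = suc n} h = cong (h 0 ∷_) (toList-applyUpTo (λ i → h (suc i)))

applyUpTo-+ : ∀ {A : Set} (h : ℕ → A) a b → applyUpTo h (a + b) ≡ applyUpTo h a ++ applyUpTo (λ i → h (a + i)) b
applyUpTo-+ h zero    b = refl
applyUpTo-+ h (suc a) b = cong (h 0 ∷_) (applyUpTo-+ (λ i → h (suc i)) a b)

applyUpTo-cong : ∀ {A : Set} {h h′ : ℕ → A} a → (∀ {i} → i < a → h i ≡ h′ i) → applyUpTo h a ≡ applyUpTo h′ a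
applyUpTo-cong zero    h≡h′ = refl
applyUpTo-cong (suc a) h≡h′ = cong₂ _∷_ (h≡h′ z<s) (applyUpTo-cong a (λ i<a → h≡h′ (s≤s i<a)))

doubled : ∀ {A : Set} (f : ℕ → A) xs → concatMap (λ x → f x ∷ f x ∷ []) xs ↭ map f xs ++ map f xs
doubled f []       = ↭-refl
doubled f (x ∷ xs) = prep (f x) (↭-trans (prep (f x) (doubled f xs)) (↭-sym (shift (f x) (map f xs) (map f xs))))

-- The index set Fin (m + (m + 1)) as two blocks of m positions (called odd and
-- even) followed by one central position.
module ThreeBlocks (m : ℕ) where

  K : ℕ
  K = m + (m + 1)

  data Block : Set where
    odd even : Block

  pos : Block → Fin m → Fin K
  pos odd  j = j ↑ˡ (m + 1)
  pos even j = m ↑ʳ (j ↑ˡ 1)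

  centre : Fin K
  centre = m ↑ʳ (m ↑ʳ zero)

  pos-injective : ∀ β → Injective _≡_ _≡_ (pos β)
  pos-injective odd  = Fin.↑ˡ-injective (m + 1) _ _
  pos-injective even = Fin.↑ˡ-injective 1 _ _ ∘′ Fin.↑ʳ-injective m _ _

  data Slot : Fin K → Set where
    block  : ∀ β j → Slot (pos β j)
    middle : Slot centre

  slot : ∀ t → Slot t
  slot t with splitAt m t in t≡
  ... | inj₁ j = subst Slot (Fin.splitAt⁻¹-↑ˡ t≡) (block odd j)
  ... | inj₂ t′ with splitAt m t′ in t′≡
  ...   | inj₁ j    = subst Slot (trans (cong (m ↑ʳ_) (Fin.splitAt⁻¹-↑ˡ t′≡)) (Fin.splitAt⁻¹-↑ʳ t≡)) (block even j)
  ...   | inj₂ zero = subst Slot (trans (cong (m ↑ʳ_) (Fin.splitAt⁻¹-↑ʳ t′≡)) (Fin.splitAt⁻¹-↑ʳ t≡)) middle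

  blocks : ∀ {A : Set} → (Fin m → A) → (Fin m → A) → A → Fin K → A
  blocks a b c = a Vector.++ (b Vector.++ λ _ → c)

  blocks-pos : ∀ {A : Set} (a b : Fin m → A) c j → blocks a b c (pos odd j) ≡ a j × blocks a b c (pos even j) ≡ b j
  blocks-pos a b c j =
    Vector.lookup-++ˡ a _ j ,
    trans (Vector.lookup-++ʳ a _ (j ↑ˡ 1)) (Vector.lookup-++ˡ b _ j)

  blocks-centre : ∀ {A : Set} (a b : Fin m → A) c → blocks a b c centre ≡ c
  blocks-centre a b c = trans (Vector.lookup-++ʳ a _ (m ↑ʳ zero)) (Vector.lookup-++ʳ b _ zero)

  toList-by-blocks : ∀ {A : Set} (w : Fin K → A) →
                     toList w ≡ toList (λ j → w (pos odd j)) ++ toList (λ j → w (pos even j)) ++ w centre ∷ []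
  toList-by-blocks w = trans (toList-split m w) (cong (toList (λ j → w (pos odd j)) ++_) (toList-split m (λ i → w (m ↑ʳ i))))

  toList-blocks : ∀ {A : Set} (a b : Fin m → A) c → toList (blocks a b c) ≡ toList a ++ toList b ++ c ∷ []
  toList-blocks {A} a b c = begin
    toList w                                                          ≡⟨ toList-by-blocks w ⟩
    toList (λ j → w (pos odd j)) ++ toList (λ j → w (pos even j)) ++ w centre ∷ []
      ≡⟨ cong₂ (λ u v → u ++ v ++ w centre ∷ []) (tabulate-cong (λ j → proj₁ (blocks-pos a b c j)))
                                                 (tabulate-cong (λ j → proj₂ (blocks-pos a b c j))) ⟩
    toList a ++ toList b ++ w centre ∷ []
      ≡⟨ cong (λ z → toList a ++ toList b ++ z ∷ []) (blocks-centre a b c) ⟩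
    toList a ++ toList b ++ c ∷ []                                    ∎
    where
      open ≡-Reasoning
      w : Fin K → A
      w = blocks a b c

elt-mod-injective : ∀ {m} .{{_ : NonZero m}} → Injective _≡_ _≡_ (λ (j : Fin m) → elt j % m)
elt-mod-injective {m} {i} {j} same = elt-injective (Congruence.≈⇒≡ m
  (≤-<-trans (m∸n≤m (toℕ i) (toℕ j)) (Fin.toℕ<n i)) (≤-<-trans (m∸n≤m (toℕ j) (toℕ i)) (Fin.toℕ<n j)) same)

injective⇒WeightedPerm : ∀ {m} .{{_ : NonZero m}} (a : Fin m → ℕ) →
  Injective _≡_ _≡_ (λ j → (elt j * a j) % m) → WeightedPerm m a
injective⇒WeightedPerm {m} a inj = realise (injective⇒permutation refl residue residue-injective)
  where
    residue : Fin m → Fin m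
    residue j = fromℕ< (m%n<n (elt j * a j) m)
    residue-injective : Injective _≡_ _≡_ residue
    residue-injective same = inj (trans (sym (Fin.toℕ-fromℕ< _)) (trans (cong toℕ same) (Fin.toℕ-fromℕ< _)))
    realise : (Σ (Permutation′ m) λ π → ∀ j → π ⟨$⟩ʳ j ≡ residue j) → WeightedPerm m a
    realise (π , π≡residue) = π , λ j → trans (sym (Fin.toℕ-fromℕ< _)) (cong toℕ (sym (π≡residue j)))

WeightedPerm⇒injective : ∀ {m} .{{_ : NonZero m}} {a : Fin m → ℕ} →
  WeightedPerm m a → Injective _≡_ _≡_ (λ j → (elt j * a j) % m)
WeightedPerm⇒injective (π , π≡) {i} {j} same =
  permutation-injective π (Fin.toℕ-injective (trans (sym (π≡ i)) (trans same (π≡ j))))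

module DoublePrime (p : ℕ) (p-prime : Prime p) (p-odd : p % 2 ≡ 1) where

  open PrimeModulus p p-prime
  open Orders p p-prime

  m n N : ℕ
  m = p ∸ 1
  n = 2 * p
  N = n ∸ 1

  instance
    m≢0 : NonZero m
    m≢0 = >-nonZero (m<n⇒0<n∸m 1<p)
    n≢0 : NonZero n
    n≢0 = m*n≢0 2 p

  open ThreeBlocks m
  module Mod2 = Congruence 2
  module ModM = Congruence m
  module ModN = Congruence n

  K≡N : K ≡ N
  K≡N = sym (trans (cong (λ q → 2 * q ∸ 1) (sym 1+[p∸1]≡p)) (cong (m +_) (trans (+-identityʳ (suc m)) (+-comm 1 m))))

  p<n : p < n
  p<n = m<m+n p (<-≤-trans (<-trans z<s 1<p) (m≤m+n p 0))

  crt : ∀ {u w} → u < n → w < n → u % 2 ≡ w % 2 → u ≈ w → u ≡ w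
  crt {u} {w} u<n w<n u≡w[2] u≡w[p] =
    ModN.∣∸⇒≡ (≤-<-trans (m∸n≤m u w) u<n) (≤-<-trans (m∸n≤m w u) w<n)
      (n∣∸ u≡w[2] u≡w[p]) (n∣∸ (sym u≡w[2]) (sym u≡w[p]))
    where
      2⊥p : Coprime 2 p
      2⊥p = Coprime.sym (prime∤⇒coprime prime[2] λ 2∣p → 0≢1+n (trans (sym (n∣m⇒m%n≡0 p 2 2∣p)) p-odd))
      n∣∸ : ∀ {a b} → a % 2 ≡ b % 2 → a ≈ b → n ∣ a ∸ b
      n∣∸ {a} {b} a≡b[2] a≡b[p] = coprime-∣⇒*∣ 2⊥p (Mod2.≈⇒∣∸ {a} {b} a≡b[2]) (≈⇒∣∸ {a} {b} a≡b[p])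

  %n-parity : ∀ y → y % n % 2 ≡ y % 2
  %n-parity y = m∣n⇒o%n%m≡o%m 2 n y (divides p (*-comm 2 p))

  %n-residue : ∀ y → y % n ≈ y
  %n-residue y = m∣n⇒o%n%m≡o%m p n y (divides 2 refl)

  ^-parity : ∀ x {e} → 0 < e → x ^ e % 2 ≡ x % 2
  ^-parity x {suc e} _ =
    trans (Mod2.^-cong {x} {x % 2} (suc e) (sym (Mod2.%-≈ x))) (trans (cong (_% 2) (bit-power (x % 2) (m%n<n x 2))) (Mod2.%-≈ x))
    where
      bit-power : ∀ b → b < 2 → b ^ suc e ≡ b
      bit-power 0 _ = refl
      bit-power 1 _ = ^-zeroˡ (suc e)
      bit-power (suc (suc _)) (s≤s (s≤s ()))

  -- For a residue r and a parity β ∈ {0, 1}, lift β r has parity β and residue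
  -- r: it adds p to r exactly when r has the wrong parity.
  lift : ℕ → ℕ → ℕ
  lift β r = r + (r + β) % 2 * p

  lift-parity : ∀ β r → β < 2 → lift β r % 2 ≡ β
  lift-parity β r β<2 = begin
    (r + (r + β) % 2 * p) % 2 ≡⟨ Mod2.+-cong {r} {r} {(r + β) % 2 * p} {(r + β) * 1} refl
                                   (Mod2.*-cong {(r + β) % 2} {r + β} {p} {1} (Mod2.%-≈ (r + β)) p-odd) ⟩
    (r + (r + β) * 1) % 2     ≡⟨ cong (_% 2) (solve 2 (λ r β → r :+ (r :+ β) :* con 1 := β :+ r :* con 2) refl r β) ⟩
    (β + r * 2) % 2           ≡⟨ [m+kn]%n≡m%n β r 2 ⟩
    β % 2                     ≡⟨ m<n⇒m%n≡m β<2 ⟩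
    β                         ∎
    where open ≡-Reasoning

  lift-residue : ∀ β r → lift β r ≈ r
  lift-residue β r = [m+kn]%n≡m%n r ((r + β) % 2) p

  lift-positive : ∀ β {r} → 0 < r → 0 < lift β r
  lift-positive β {r} 0<r = <-≤-trans 0<r (m≤m+n r _)

  lift<n : ∀ β {r} → r < p → lift β r < n
  lift<n β {r} r<p = subst (lift β r <_) (cong (p +_) (sym (+-identityʳ p)))
    (+-mono-<-≤ r<p (≤-trans (*-monoˡ-≤ p (s≤s⁻¹ (m%n<n (r + β) 2))) (≤-reflexive (+-identityʳ p))))

  -- Exponents matter only modulo m; reduce picks the representative in {1, …, m}.
  reduce : ℕ → ℕ
  reduce e = suc ((e ∸ 1) % m)

  reduce-≈ : ∀ {e} → 0 < e → reduce e % m ≡ e % m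
  reduce-≈ {suc e} _ = ModM.+-cong {1} {1} {e % m} {e} refl (ModM.%-≈ e)

  -- The reduced exponents of 1, …, n-1 = 2m+1 form the multiset S: the first and
  -- the second m numbers each give 1, …, m, and 2m+1 gives 1 again.
  R : Fin N → ℕ
  R i = reduce (elt i)

  R↭S : toList R ↭ multisetS p
  R↭S = begin
    toList R                                      ≡⟨ toList-applyUpTo h ⟩
    applyUpTo h N                                 ≡⟨ cong (applyUpTo h) K≡N ⟨
    applyUpTo h (m + (m + 1))                     ≡⟨ applyUpTo-+ h m (m + 1) ⟩
    applyUpTo h m ++ applyUpTo (λ i → h (m + i)) (m + 1)
      ≡⟨ cong (applyUpTo h m ++_) (applyUpTo-+ (λ i → h (m + i)) m 1) ⟩
    applyUpTo h m ++ applyUpTo (λ i → h (m + i)) m ++ h (m + (m + 0)) ∷ []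
      ≡⟨ cong₂ (λ u v → u ++ v ++ h (m + (m + 0)) ∷ []) (applyUpTo-cong m first-copy) (applyUpTo-cong m second-copy) ⟩
    A ++ A ++ h (m + (m + 0)) ∷ []                ≡⟨ cong (λ r → A ++ A ++ suc r ∷ []) last-is-1 ⟩
    A ++ A ++ 1 ∷ []                              ≡⟨ ++-assoc A A (1 ∷ []) ⟨
    (A ++ A) ++ 1 ∷ []                            ↭⟨ ∷↭∷ʳ 1 (A ++ A) ⟨
    1 ∷ A ++ A                                    ≡⟨ cong (λ B → 1 ∷ B ++ B) (map-applyUpTo id suc m) ⟨
    1 ∷ map suc (upTo m) ++ map suc (upTo m)      ↭⟨ prep 1 (doubled suc (upTo m)) ⟨
    multisetS p                                   ∎
    where
      open PermutationReasoning
      h : ℕ → ℕ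
      h i = suc (i % m)
      A : List ℕ
      A = applyUpTo suc m
      first-copy : ∀ {i} → i < m → h i ≡ suc i
      first-copy i<m = cong suc (m<n⇒m%n≡m i<m)
      second-copy : ∀ {i} → i < m → h (m + i) ≡ suc i
      second-copy {i} i<m = cong suc (trans (cong (_% m) (+-comm m i)) (trans ([m+n]%n≡m%n i m) (m<n⇒m%n≡m i<m)))
      last-is-1 : (m + (m + 0)) % m ≡ 0
      last-is-1 = m*n%n≡0 2 m

  -- A primitive root g identifies the positions of ThreeBlocks m with {1, …, n-1}:
  -- position (β, j) is the number of parity β with residue g^{elt j}, the centre is p.
  module Coordinates (g : ℕ) (ug : Unit g) (og : IsOrder g m) where

    block-parity : Block → ℕ
    block-parity odd  = 1
    block-parity even = 0

    block-parity<2 : ∀ β → block-parity β < 2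
    block-parity<2 odd  = s≤s (s≤s z≤n)
    block-parity<2 even = s≤s z≤n

    value : Block → Fin m → ℕ
    value β j = lift (block-parity β) (g ^ elt j % p)

    X : Fin K → ℕ
    X = blocks (value odd) (value even) p

    X-block : ∀ β j → X (pos β j) ≡ value β j
    X-block odd  j = proj₁ (blocks-pos (value odd) (value even) p j)
    X-block even j = proj₂ (blocks-pos (value odd) (value even) p j)

    X-centre : X centre ≡ p
    X-centre = blocks-centre (value odd) (value even) p

    slot-parity : ∀ {t} → Slot t → ℕ
    slot-parity (block β j) = block-parity β
    slot-parity middle      = 1

    X-parity : ∀ {t} (s : Slot t) → X t % 2 ≡ slot-parity s
    X-parity (block β j) = trans (cong (_% 2) (X-block β j)) (lift-parity (block-parity β) (g ^ elt j % p) (block-parity<2 β))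
    X-parity middle      = trans (cong (_% 2) X-centre) p-odd

    X-block-residue : ∀ β j → X (pos β j) ≈ g ^ elt j
    X-block-residue β j = trans (cong (_% p) (X-block β j)) (trans (lift-residue (block-parity β) (g ^ elt j % p)) (%-≈ (g ^ elt j)))

    X-centre-residue : X centre ≈ 0
    X-centre-residue = trans (cong (_% p) X-centre) (trans (n%n≡0 p) (sym 0%d≡0))

    X-range : ∀ {t} → Slot t → 0 < X t × X t < n
    X-range (block β j) = subst (λ x → 0 < x × x < n) (sym (X-block β j))
      (lift-positive (block-parity β) (unit-residue>0 (unit-^ (elt j) ug)) , lift<n (block-parity β) (m%n<n _ p))
    X-range middle = subst (λ x → 0 < x × x < n) (sym X-centre) (<-trans z<s 1<p , p<n)

    module Powers (E : Fin K → ℕ) (E>0 : ∀ t → 0 < E t) where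

      Y : Fin K → ℕ
      Y t = X t ^ E t % n

      weight : Block → Fin m → ℕ
      weight β j = (elt j * E (pos β j)) % m

      Y<n : ∀ t → Y t < n
      Y<n t = m%n<n (X t ^ E t) n

      Y-parity : ∀ {t} (s : Slot t) → Y t % 2 ≡ slot-parity s
      Y-parity {t} s = trans (%n-parity (X t ^ E t)) (trans (^-parity (X t) (E>0 t)) (X-parity s))

      Y-block-residue : ∀ β j → Y (pos β j) ≈ g ^ (elt j * E (pos β j))
      Y-block-residue β j = begin
        X t ^ E t % n % p       ≡⟨ %n-residue (X t ^ E t) ⟩
        X t ^ E t % p           ≡⟨ ^-cong (E t) (X-block-residue β j) ⟩
        (g ^ elt j) ^ E t % p   ≡⟨ cong (_% p) (^-*-assoc g (elt j) (E t)) ⟩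
        g ^ (elt j * E t) % p   ∎
        where
          open ≡-Reasoning
          t = pos β j

      Y-block-unit : ∀ β j → Unit (Y (pos β j))
      Y-block-unit β j Y≈0 = unit-^ (elt j * E (pos β j)) ug (trans (sym (Y-block-residue β j)) Y≈0)

      Y-centre-residue : Y centre ≈ 0
      Y-centre-residue = begin
        X centre ^ E centre % n % p ≡⟨ %n-residue (X centre ^ E centre) ⟩
        X centre ^ E centre % p     ≡⟨ ^-cong (E centre) X-centre-residue ⟩
        0 ^ E centre % p            ≡⟨ cong (_% p) (0^positive (E>0 centre)) ⟩
        0 % p                       ∎
        where
          open ≡-Reasoning
          0^positive : ∀ {e} → 0 < e → 0 ^ e ≡ 0
          0^positive {suc e} _ = refl

      Y-positive : ∀ t → 0 < Y t
      Y-positive t = n≢0⇒n>0 (nonzero (slot t))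
        where
          nonzero : ∀ {t} → Slot t → Y t ≢ 0
          nonzero (block β j) Y≡0 = Y-block-unit β j (trans (cong (_% p) Y≡0) refl)
          nonzero middle Y≡0 = 0≢1+n (trans (cong (_% 2) (sym Y≡0)) (Y-parity middle))

      Y-block-≡⇔ : ∀ β j j′ → Y (pos β j) ≡ Y (pos β j′) ⇔ weight β j ≡ weight β j′
      Y-block-≡⇔ β j j′ = mk⇔
        (λ Y≡ → Equivalence.to (^-≈⇔ ug og)
          (trans (sym (Y-block-residue β j)) (trans (cong (_% p) Y≡) (Y-block-residue β j′))))
        (λ weight≡ → crt (Y<n _) (Y<n _)
          (trans (Y-parity (block β j)) (sym (Y-parity (block β j′))))
          (trans (Y-block-residue β j) (trans (Equivalence.from (^-≈⇔ ug og) weight≡) (sym (Y-block-residue β j′)))))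

      Y-injective : (∀ β → Injective _≡_ _≡_ (weight β)) → Injective _≡_ _≡_ Y
      Y-injective weight-injective {t} {t′} = separate (slot t) (slot t′)
        where
          same-parity : ∀ {t t′} (s : Slot t) (s′ : Slot t′) → Y t ≡ Y t′ → slot-parity s ≡ slot-parity s′
          same-parity s s′ Y≡ = trans (sym (Y-parity s)) (trans (cong (_% 2) Y≡) (Y-parity s′))

          separate : ∀ {t t′} → Slot t → Slot t′ → Y t ≡ Y t′ → t ≡ t′
          separate (block odd j)  (block odd j′)  Y≡ =
            cong (pos odd) (weight-injective odd (Equivalence.to (Y-block-≡⇔ odd j j′) Y≡))
          separate (block even j) (block even j′) Y≡ =
            cong (pos even) (weight-injective even (Equivalence.to (Y-block-≡⇔ even j j′) Y≡))
          separate middle middle _ = refl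
          separate s@(block odd _)  s′@(block even _) Y≡ = contradiction (same-parity s s′ Y≡) λ ()
          separate s@(block even _) s′@(block odd _)  Y≡ = contradiction (same-parity s s′ Y≡) λ ()
          separate s@(block even _) middle            Y≡ = contradiction (same-parity s middle Y≡) λ ()
          separate middle           s′@(block even _) Y≡ = contradiction (same-parity middle s′ Y≡) λ ()
          separate (block odd j) middle Y≡ =
            ⊥-elim (Y-block-unit odd j (trans (cong (_% p) Y≡) Y-centre-residue))
          separate middle (block odd j) Y≡ =
            ⊥-elim (Y-block-unit odd j (trans (cong (_% p) (sym Y≡)) Y-centre-residue))

    -- With all exponents 1 the weights are elt j mod m, so distinct positions
    -- carry distinct numbers.
    module Exponent-one = Powers (λ _ → 1) (λ _ → z<s)

    X-injective : Injective _≡_ _≡_ X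
    X-injective X≡ = Exponent-one.Y-injective
      (λ β {j} {j′} same → elt-mod-injective
        (subst₂ (λ u v → u % m ≡ v % m) (*-identityʳ (elt j)) (*-identityʳ (elt j′)) same))
      (cong (λ x → x ^ 1 % n) X≡)

    en : Fin K → Fin N
    en t = index (X t) (proj₁ (X-range (slot t))) (proj₂ (X-range (slot t)))

    elt-en : ∀ t → elt (en t) ≡ X t
    elt-en t = elt-index (X t) (proj₁ (X-range (slot t))) (proj₂ (X-range (slot t)))

    en-injective : Injective _≡_ _≡_ en
    en-injective {t} {t′} en≡ = X-injective (trans (sym (elt-en t)) (trans (cong elt en≡) (elt-en t′)))

    encoding : Σ (Permutation K N) λ ε → ∀ t → ε ⟨$⟩ʳ t ≡ en t
    encoding = injective⇒permutation K≡N en en-injective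

    ε : Permutation K N
    ε = proj₁ encoding

    ε-en : ∀ t → ε ⟨$⟩ʳ t ≡ en t
    ε-en = proj₂ encoding

    -- From an exponential orthomorphism (σ, τ): reduce the exponent σ(x) of every
    -- x; injectivity of τ makes both blocks of reduced exponents weighted permutations.
    module Forward (σ τ : Permutation′ N) (law : ∀ i → (elt i ^ elt (σ ⟨$⟩ʳ i)) % n ≡ elt (τ ⟨$⟩ʳ i)) where

      E : Fin K → ℕ
      E t = elt (σ ⟨$⟩ʳ en t)

      open Powers E (λ _ → z<s)

      Y≡τ : ∀ t → Y t ≡ elt (τ ⟨$⟩ʳ en t)
      Y≡τ t = trans (cong (λ x → x ^ E t % n) (sym (elt-en t))) (law (en t))

      Y-is-injective : Injective _≡_ _≡_ Y
      Y-is-injective {t} {t′} Y≡ =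
        en-injective (permutation-injective τ (elt-injective (trans (sym (Y≡τ t)) (trans Y≡ (Y≡τ t′)))))

      L : Fin K → ℕ
      L t = reduce (E t)

      L-weight : ∀ β j → (elt j * L (pos β j)) % m ≡ weight β j
      L-weight β j = ModM.*-cong {elt j} {elt j} {L (pos β j)} {E (pos β j)} refl (reduce-≈ z<s)

      L-weighted : ∀ β → WeightedPerm m (λ j → L (pos β j))
      L-weighted β = injective⇒WeightedPerm _ λ {j} {j′} same → pos-injective β (Y-is-injective
        (Equivalence.from (Y-block-≡⇔ β j j′) (trans (sym (L-weight β j)) (trans same (L-weight β j′)))))

      -- The reduced exponents are those of 1, …, n-1 rearranged by σ.
      L↭S : toList L ↭ multisetS p
      L↭S = begin
        toList L                                 ≡⟨ tabulate-cong (λ t → cong (λ i → R (σ ⟨$⟩ʳ i)) (sym (ε-en t))) ⟩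
        toList (λ t → R ((ε Perm.∘ₚ σ) ⟨$⟩ʳ t))  ↭⟨ toList-permute R (ε Perm.∘ₚ σ) ⟩
        toList R                                 ↭⟨ R↭S ⟩
        multisetS p                              ∎
        where open PermutationReasoning

      exponent-data : Σ (Fin m → ℕ) λ a → Σ (Fin m → ℕ) λ b → Σ ℕ λ c →
               ((toList a ++ toList b ++ (c ∷ [])) ↭ multisetS p) × WeightedPerm m a × WeightedPerm m b
      exponent-data = (λ j → L (pos odd j)) , (λ j → L (pos even j)) , L centre ,
               ↭-trans (↭-reflexive (sym (toList-by-blocks L))) L↭S , L-weighted odd , L-weighted even

    -- From the data (a, b, c): match positions with elements of {1, …, n-1}
    -- carrying the prescribed reduced exponents; the weighted permutations make
    -- x ↦ x^σ(x) injective.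
    module Backward (a b : Fin m → ℕ) (c : ℕ) (abc↭S : (toList a ++ toList b ++ (c ∷ [])) ↭ multisetS p)
                    (a-weighted : WeightedPerm m a) (b-weighted : WeightedPerm m b) where

      L : Fin K → ℕ
      L = blocks a b c

      -- Both L and R list S, so some bijection ρ matches positions with elements of
      -- {1, …, n-1} of the same reduced exponent; E t is the element matched with t.
      matching : Σ (Permutation K N) λ ρ → ∀ t → L t ≡ R (ρ ⟨$⟩ʳ t)
      matching = ↭⇒permutation L R (↭-trans (↭-reflexive (toList-blocks a b c)) (↭-trans abc↭S (↭-sym R↭S)))

      ρ : Permutation K N
      ρ = proj₁ matching

      E : Fin K → ℕ
      E t = elt (ρ ⟨$⟩ʳ t)

      open Powers E (λ _ → z<s)

      block-data : Block → Fin m → ℕ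
      block-data odd  = a
      block-data even = b

      block-data-weighted : ∀ β → WeightedPerm m (block-data β)
      block-data-weighted odd  = a-weighted
      block-data-weighted even = b-weighted

      L-block : ∀ β j → L (pos β j) ≡ block-data β j
      L-block odd  j = proj₁ (blocks-pos a b c j)
      L-block even j = proj₂ (blocks-pos a b c j)

      data-weight : ∀ β j → (elt j * block-data β j) % m ≡ weight β j
      data-weight β j = ModM.*-cong {elt j} {elt j} {block-data β j} {E (pos β j)} refl
        (trans (cong (_% m) (trans (sym (L-block β j)) (proj₂ matching (pos β j)))) (reduce-≈ z<s))

      weight-injective : ∀ β → Injective _≡_ _≡_ (weight β)
      weight-injective β {j} {j′} same = WeightedPerm⇒injective (block-data-weighted β)
        (trans (data-weight β j) (trans same (sym (data-weight β j′))))

      -- σ sends the number at position t to E t.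
      σ : Permutation′ N
      σ = Perm.flip ε Perm.∘ₚ ρ

      T : Fin N → ℕ
      T v = (elt v ^ elt (σ ⟨$⟩ʳ v)) % n

      T≡Y : ∀ v → T v ≡ Y (ε ⟨$⟩ˡ v)
      T≡Y v = cong (λ x → x ^ E t % n) (trans (cong elt v≡en[t]) (elt-en t))
        where
          t : Fin K
          t = ε ⟨$⟩ˡ v
          v≡en[t] : v ≡ en t
          v≡en[t] = trans (sym (Perm.inverseʳ ε)) (ε-en t)

      T-positive : ∀ v → 0 < T v
      T-positive v = subst (0 <_) (sym (T≡Y v)) (Y-positive (ε ⟨$⟩ˡ v))

      T<n : ∀ v → T v < n
      T<n v = m%n<n (elt v ^ elt (σ ⟨$⟩ʳ v)) n

      power-index : Fin N → Fin N
      power-index v = index (T v) (T-positive v) (T<n v)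

      power-index-injective : Injective _≡_ _≡_ power-index
      power-index-injective {v} {v′} same = permutation-injective (Perm.flip ε) (Y-injective weight-injective
        (trans (sym (T≡Y v)) (trans T≡T′ (T≡Y v′))))
        where
          T≡T′ : T v ≡ T v′
          T≡T′ = index-injective {n} {T v} {T v′} (T-positive v) (T-positive v′) (T<n v) (T<n v′) same

      τ-realises-T : Σ (Permutation′ N) λ τ → ∀ v → τ ⟨$⟩ʳ v ≡ power-index v
      τ-realises-T = injective⇒permutation refl power-index power-index-injective

      orthomorphism : ExpOrthomorphism n
      orthomorphism = σ , proj₁ τ-realises-T , λ v →
        sym (trans (cong elt (proj₂ τ-realises-T v)) (elt-index (T v) (T-positive v) (T<n v)))

proposition3p4 : (k : ℕ) → Prime (suc (suc (suc (2 * k)))) →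
    let p = suc (suc (suc (2 * k))) in
    ExpOrthomorphism (2 * p)
      ⇔ Σ (Fin (suc (suc (2 * k))) → ℕ) λ a → Σ (Fin (suc (suc (2 * k))) → ℕ) λ b → Σ ℕ λ c →
          ((toList a ++ toList b ++ (c ∷ [])) ↭ multisetS p)
            × WeightedPerm (suc (suc (2 * k))) a × WeightedPerm (suc (suc (2 * k))) b
proposition3p4 k p-prime =
  mk⇔ (λ (σ , τ , law) → Forward.exponent-data σ τ law)
      (λ (a , b , c , abc↭S , a-weighted , b-weighted) → Backward.orthomorphism a b c abc↭S a-weighted b-weighted)
  where
    p : ℕ
    p = suc (suc (suc (2 * k)))

    p-odd : p % 2 ≡ 1
    p-odd = trans (cong (_% 2) (solve 1 (λ k → con 3 :+ con 2 :* k := con 1 :+ (con 1 :+ k) :* con 2) refl k))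
                  ([m+kn]%n≡m%n 1 (suc k) 2)

    open Orders p p-prime using (primitive-root)
    open DoublePrime p p-prime p-odd
    open Coordinates (proj₁ primitive-root) (proj₁ (proj₂ primitive-root)) (proj₂ (proj₂ primitive-root))
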